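{- For all integers $n\ge 5$, $$\sum_{j=0}^{\lfloor n/2\rfloor}\chi^{(n-j,j)}\big(5\,1^{n-5}\big)^2=\frac{n^4-38n^3+659n^2-4342n+10080}{16(2n-1)(2n-3)(2n-5)(2n-7)(n+1)}\binom{2n}{n}.$$
   Context: For partitions $\lambda,\mu$ of $n$, $\chi^{\lambda}(\mu)$ is the value of the irreducible character of $S_n$ indexed by $\lambda$ on permutations of cycle type $\mu$. $(n-j,j)$ is the shape with rows $n-j$ and $j$ (one row when $j=0$); $5\,1^{n-5}$ is the partition of $n$ with one part $5$ and $n-5$ parts $1$. -}

module Defs where

open import Data.Bool using (Bool; true; false; if_then_else_; _∧_; not)
open import Data.Nat as ℕ using (ℕ; zero; suc; _∸_; _≡ᵇ_; _<ᵇ_; _≤ᵇ_)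
open import Data.Integer as ℤ using (ℤ; +_)
open import Data.List using (List; []; _∷_; map; foldr; length; upTo; filterᵇ)
open import Data.Bool.ListAction using (any)
open import Data.Nat.ListAction using (sum)

sumℤ : List ℤ → ℤ
sumℤ = foldr ℤ._+_ (+ 0)

signℤ : ℕ → ℤ
signℤ zero = + 1
signℤ (suc k) = ℤ.- signℤ k

_∈ᵇ_ : ℕ → List ℕ → Bool
c ∈ᵇ β = any (λ x → x ≡ᵇ c) β

-- Beta-set (first-column hook lengths) of a partition λ = (λ₁ ≥ … ≥ λ_ℓ):
-- βᵢ = λᵢ + (ℓ - i) for i = 1..ℓ.
betaSet : List ℕ → List ℕ
betaSet λs = go λs (length λs)
  where
  go : List ℕ → ℕ → List ℕ
  go [] _ = []
  go (x ∷ xs) l = (x ℕ.+ (l ∸ 1)) ∷ go xs (l ∸ 1)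

-- Removing a rim hook of length k
-- from the partition with beta-set β corresponds to replacing some b ∈ β
-- by b - k ≥ 0 with b - k ∉ β; the sign is (-1)^(leg length), the leg
-- length being the number of elements of β strictly between b - k and b.
-- Base case: the empty cycle type gives 1 on the empty partition
-- (beta-set {0,…,ℓ-1}) and 0 otherwise.
mnβ : List ℕ → List ℕ → ℤ
mnβ β [] = if sum β ≡ᵇ sum (upTo (length β)) then + 1 else + 0
mnβ β (k ∷ μ) = sumℤ (map term β)
  where
  term : ℕ → ℤ
  term b =
    if (k ≤ᵇ b) ∧ not ((b ∸ k) ∈ᵇ β)
    then signℤ (length (filterᵇ (λ x → ((b ∸ k) <ᵇ x) ∧ (x <ᵇ b)) β))
           ℤ.* mnβ (map (λ x → if x ≡ᵇ b then b ∸ k else x) β) μ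
    else + 0

-- χ^λ(μ): value of the irreducible character of S_n indexed by the
-- partition λ (list of parts, weakly decreasing) on permutations of
-- cycle type μ (list of cycle lengths), via the Murnaghan–Nakayama rule.
χ : List ℕ → List ℕ → ℤ
χ λs μ = mnβ (betaSet λs) μ

twoRow : ℕ → ℕ → List ℕ
twoRow n zero = n ∷ []
twoRow n (suc j) = (n ∸ suc j) ∷ suc j ∷ []

ones : ℕ → List ℕ
ones zero = []
ones (suc m) = 1 ∷ ones m

fiveOnes : ℕ → List ℕ
fiveOnes n = 5 ∷ ones (n ∸ 5)

lhsSum : ℕ → ℤ
lhsSum n = sumℤ (map (λ j → χ (twoRow n j) (fiveOnes n) ℤ.* χ (twoRow n j) (fiveOnes n))
                     (upTo (suc (n ℕ./ 2))))

module Submission where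

open import Defs
open import Data.Nat using (ℕ; _≤_) renaming (_*_ to _*ℕ_)
open import Data.Nat.Combinatorics using (_C_)
open import Data.Integer using (ℤ; +_; _+_; _-_; _*_)
open import Relation.Binary.PropositionalEquality using (_≡_)

open import Data.Bool using (true; false; if_then_else_; _∧_; not)
open import Data.Nat as ℕ using (zero; suc; _∸_; _<_; z≤n; s≤s; _≡ᵇ_; _<ᵇ_; _≤ᵇ_)
import Data.Nat.Properties as ℕ
import Data.Nat.Tactic.RingSolver as ℕ-Solver
open import Data.Nat.Combinatorics using (nCk+nC[k+1]≡[n+1]C[k+1]; nCk≡nC[n∸k]; k>n⇒nCk≡0; nC1≡n)
open import Data.Nat.DivMod using (_/_; _%_; m≡m%n+[m/n]*n; m%n<n)
open import Data.Integer as ℤ using (-[1+_]; -_)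
import Data.Integer.Properties as ℤ
open import Data.Integer.Tactic.RingSolver using (solve-∀)
open import Data.List using (List; []; _∷_; map; applyUpTo; length; filterᵇ)
open import Data.Product using (_,_)
open import Data.Sum using (_⊎_; inj₁; inj₂)
open import Function using (_∘_; id)
open import Relation.Binary.Definitions using (tri<; tri≈; tri>)
open import Relation.Binary.PropositionalEquality using (refl; sym; trans; cong; cong₂; subst; _≢_; module ≡-Reasoning)
open import Relation.Nullary using (¬_; _because_; yes; no; contradiction)
open import Relation.Nullary.Decidable using (True; toWitness; dec-true; dec-false)
open ≡-Reasoning

-- Write n = m + 5 and c(t) = C(m, t) for t ∈ ℤ (zero outside [0, m]). The
-- Murnaghan–Nakayama rule, applied to the beta-set {n - j + 1, j} of the shape
-- (n - j, j), gives χ^(n-j,j)(5 1^m) = c(j) - c(j-1) + c(j-5) - c(j-6). This is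
-- antisymmetric under j ↦ m + 6 - j, so the sum of its squares over j ≤ ⌊n/2⌋ is
-- half the sum over all j. Expanding the square, Vandermonde's identity evaluates
-- each Σ_j c(j-a) c(j-b) as C(2m, m+|a-b|). The resulting combination of the
-- C(2m, m+d), d ∈ {0, 1, 4, 5, 6}, and C(2n, n) are both rational multiples of
-- C(2m, m); multiplying through by (m+1)⋯(m+6) leaves a polynomial identity in m.

-- Sums and products over initial segments of ℕ

∑< : ℕ → (ℕ → ℤ) → ℤ
∑< zero    f = + 0
∑< (suc L) f = f 0 + ∑< L (f ∘ suc)

∏< : ℕ → (ℕ → ℤ) → ℤ
∏< zero    f = + 1
∏< (suc k) f = ∏< k f * f k

sumℤ-map-applyUpTo : ∀ L (g : ℕ → ℤ) f → sumℤ (map g (applyUpTo f L)) ≡ ∑< L (g ∘ f)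
sumℤ-map-applyUpTo zero    g f = refl
sumℤ-map-applyUpTo (suc L) g f = cong (_+_ (g (f 0))) (sumℤ-map-applyUpTo L g (f ∘ suc))

∑<-cong : ∀ L {f g : ℕ → ℤ} → (∀ i → i < L → f i ≡ g i) → ∑< L f ≡ ∑< L g
∑<-cong zero    eq = refl
∑<-cong (suc L) eq = cong₂ _+_ (eq 0 (s≤s z≤n)) (∑<-cong L (λ i i<L → eq (suc i) (s≤s i<L)))

∑<-0 : ∀ L → ∑< L (λ _ → + 0) ≡ + 0
∑<-0 zero    = refl
∑<-0 (suc L) = trans (ℤ.+-identityˡ _) (∑<-0 L)

∑<-distrib-+ : ∀ L (f g : ℕ → ℤ) → ∑< L (λ i → f i + g i) ≡ ∑< L f + ∑< L g
∑<-distrib-+ zero    f g = refl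
∑<-distrib-+ (suc L) f g = begin
  (f 0 + g 0) + ∑< L (λ i → f (suc i) + g (suc i))
    ≡⟨ cong (_+_ (f 0 + g 0)) (∑<-distrib-+ L (f ∘ suc) (g ∘ suc)) ⟩
  (f 0 + g 0) + (∑< L (f ∘ suc) + ∑< L (g ∘ suc))
    ≡⟨ interchange (f 0) (g 0) _ _ ⟩
  (f 0 + ∑< L (f ∘ suc)) + (g 0 + ∑< L (g ∘ suc)) ∎
  where
  interchange : ∀ a b c d → (a + b) + (c + d) ≡ (a + c) + (b + d)
  interchange = solve-∀

∑<-distribˡ-* : ∀ L c (f : ℕ → ℤ) → ∑< L (λ i → c * f i) ≡ c * ∑< L f
∑<-distribˡ-* zero    c f = sym (ℤ.*-zeroʳ c)
∑<-distribˡ-* (suc L) c f = begin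
  c * f 0 + ∑< L (λ i → c * f (suc i)) ≡⟨ cong (_+_ (c * f 0)) (∑<-distribˡ-* L c (f ∘ suc)) ⟩
  c * f 0 + c * ∑< L (f ∘ suc)         ≡⟨ ℤ.*-distribˡ-+ c (f 0) _ ⟨
  c * (f 0 + ∑< L (f ∘ suc))           ∎

∑<-linear : ∀ L c (f g : ℕ → ℤ) {w r} → ∑< L f ≡ w → ∑< L g ≡ r → ∑< L (λ i → c * f i + g i) ≡ c * w + r
∑<-linear L c f g ∑f≡w ∑g≡r =
  trans (∑<-distrib-+ L (λ i → c * f i) g) (cong₂ _+_ (trans (∑<-distribˡ-* L c f) (cong (c *_) ∑f≡w)) ∑g≡r)

∑<-+ : ∀ a b (f : ℕ → ℤ) → ∑< (a ℕ.+ b) f ≡ ∑< a f + ∑< b (λ i → f (a ℕ.+ i))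
∑<-+ zero    b f = sym (ℤ.+-identityˡ _)
∑<-+ (suc a) b f = trans (cong (_+_ (f 0)) (∑<-+ a b (f ∘ suc))) (sym (ℤ.+-assoc (f 0) _ _))

∑<-suc : ∀ L (f : ℕ → ℤ) → ∑< (suc L) f ≡ ∑< L f + f L
∑<-suc zero    f = trans (ℤ.+-identityʳ (f 0)) (sym (ℤ.+-identityˡ (f 0)))
∑<-suc (suc L) f = trans (cong (_+_ (f 0)) (∑<-suc L (f ∘ suc))) (sym (ℤ.+-assoc (f 0) _ _))

∑<-truncate : ∀ L e (f : ℕ → ℤ) → (∀ i → L ≤ i → f i ≡ + 0) → ∑< (L ℕ.+ e) f ≡ ∑< L f
∑<-truncate L e f vanish = begin
  ∑< (L ℕ.+ e) f                    ≡⟨ ∑<-+ L e f ⟩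
  ∑< L f + ∑< e (λ i → f (L ℕ.+ i)) ≡⟨ cong (_+_ (∑< L f)) tail≡0 ⟩
  ∑< L f + + 0                      ≡⟨ ℤ.+-identityʳ _ ⟩
  ∑< L f                            ∎
  where
  tail≡0 : ∑< e (λ i → f (L ℕ.+ i)) ≡ + 0
  tail≡0 = trans (∑<-cong e (λ i _ → vanish (L ℕ.+ i) (ℕ.m≤m+n L i))) (∑<-0 e)

∑<-reverse : ∀ L (f : ℕ → ℤ) → ∑< L (λ i → f (L ∸ suc i)) ≡ ∑< L f
∑<-reverse zero    f = refl
∑<-reverse (suc L) f = begin
  ∑< (suc L) (λ i → f (L ∸ i))           ≡⟨ ∑<-suc L (λ i → f (L ∸ i)) ⟩
  ∑< L (λ i → f (L ∸ i)) + f (L ∸ L)     ≡⟨ cong₂ _+_ (∑<-cong L (λ i i<L → cong f (ℕ.+-∸-assoc 1 i<L))) (cong f (ℕ.n∸n≡0 L)) ⟩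
  ∑< L (λ i → f (suc (L ∸ suc i))) + f 0 ≡⟨ cong (_+ f 0) (∑<-reverse L (f ∘ suc)) ⟩
  ∑< L (f ∘ suc) + f 0                   ≡⟨ ℤ.+-comm _ (f 0) ⟩
  ∑< (suc L) f                           ∎

∑<-palindrome-even : ∀ L (f : ℕ → ℤ) → (∀ i → i < L → f (L ℕ.+ L ∸ suc i) ≡ f i) →
                     ∑< (L ℕ.+ L) f ≡ + 2 * ∑< L f
∑<-palindrome-even L f mirror = begin
  ∑< (L ℕ.+ L) f                              ≡⟨ ∑<-+ L L f ⟩
  ∑< L f + ∑< L (λ i → f (L ℕ.+ i))           ≡⟨ cong (_+_ (∑< L f)) (∑<-reverse L (λ i → f (L ℕ.+ i))) ⟨
  ∑< L f + ∑< L (λ i → f (L ℕ.+ (L ∸ suc i))) ≡⟨ cong (_+_ (∑< L f)) (∑<-cong L upper-half) ⟩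
  ∑< L f + ∑< L f                             ≡⟨ double (∑< L f) ⟩
  + 2 * ∑< L f                                ∎
  where
  upper-half : ∀ i → i < L → f (L ℕ.+ (L ∸ suc i)) ≡ f i
  upper-half i i<L = trans (cong f (sym (ℕ.+-∸-assoc L i<L))) (mirror i i<L)
  double : ∀ x → x + x ≡ + 2 * x
  double = solve-∀

∑<-palindrome-odd : ∀ L (f : ℕ → ℤ) → (∀ i → i < L → f (L ℕ.+ L ∸ i) ≡ f i) → f L ≡ + 0 →
                    ∑< (L ℕ.+ suc L) f ≡ + 2 * ∑< L f
∑<-palindrome-odd L f mirror centre = begin
  ∑< (L ℕ.+ suc L) f                                     ≡⟨ ∑<-+ L (suc L) f ⟩
  ∑< L f + (f (L ℕ.+ 0) + ∑< L (λ i → f (L ℕ.+ suc i))) ≡⟨ cong (λ x → ∑< L f + (x + ∑< L (λ i → f (L ℕ.+ suc i)))) f[L+0]≡0 ⟩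
  ∑< L f + (+ 0 + ∑< L (λ i → f (L ℕ.+ suc i)))         ≡⟨ cong (_+_ (∑< L f)) (ℤ.+-identityˡ _) ⟩
  ∑< L f + ∑< L (λ i → f (L ℕ.+ suc i))                 ≡⟨ cong (_+_ (∑< L f)) (∑<-reverse L (λ i → f (L ℕ.+ suc i))) ⟨
  ∑< L f + ∑< L (λ i → f (L ℕ.+ suc (L ∸ suc i)))       ≡⟨ cong (_+_ (∑< L f)) (∑<-cong L upper-half) ⟩
  ∑< L f + ∑< L f                                        ≡⟨ double (∑< L f) ⟩
  + 2 * ∑< L f                                           ∎
  where
  f[L+0]≡0 : f (L ℕ.+ 0) ≡ + 0
  f[L+0]≡0 = trans (cong f (ℕ.+-identityʳ L)) centre
  upper-half : ∀ i → i < L → f (L ℕ.+ suc (L ∸ suc i)) ≡ f i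
  upper-half i i<L = trans (cong f (trans (cong (L ℕ.+_) (sym (ℕ.+-∸-assoc 1 i<L))) (sym (ℕ.+-∸-assoc L (ℕ.<⇒≤ i<L)))))
                           (mirror i i<L)
  double : ∀ x → x + x ≡ + 2 * x
  double = solve-∀

∏<-+ : ∀ a b (f : ℕ → ℤ) → ∏< (a ℕ.+ b) f ≡ ∏< a f * ∏< b (λ i → f (a ℕ.+ i))
∏<-+ a zero    f = trans (cong (λ k → ∏< k f) (ℕ.+-identityʳ a)) (sym (ℤ.*-identityʳ _))
∏<-+ a (suc b) f = begin
  ∏< (a ℕ.+ suc b) f                              ≡⟨ cong (λ k → ∏< k f) (ℕ.+-suc a b) ⟩
  ∏< (a ℕ.+ b) f * f (a ℕ.+ b)                    ≡⟨ cong (_* f (a ℕ.+ b)) (∏<-+ a b f) ⟩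
  ∏< a f * ∏< b (λ i → f (a ℕ.+ i)) * f (a ℕ.+ b) ≡⟨ ℤ.*-assoc (∏< a f) _ _ ⟩
  ∏< a f * ∏< (suc b) (λ i → f (a ℕ.+ i))         ∎

∏<-telescope : ∀ (a b w : ℕ → ℤ) → (∀ i → a i * w (suc i) ≡ b i * w i) →
               ∀ k → ∏< k a * w k ≡ ∏< k b * w 0
∏<-telescope a b w step zero    = refl
∏<-telescope a b w step (suc k) = begin
  ∏< k a * a k * w (suc k)   ≡⟨ ℤ.*-assoc (∏< k a) _ _ ⟩
  ∏< k a * (a k * w (suc k)) ≡⟨ cong (∏< k a *_) (step k) ⟩
  ∏< k a * (b k * w k)       ≡⟨ swap (∏< k a) (b k) (w k) ⟩
  b k * (∏< k a * w k)       ≡⟨ cong (b k *_) (∏<-telescope a b w step k) ⟩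
  b k * (∏< k b * w 0)       ≡⟨ swap (b k) (∏< k b) (w 0) ⟩
  ∏< k b * (b k * w 0)       ≡⟨ ℤ.*-assoc (∏< k b) _ _ ⟨
  ∏< k b * b k * w 0         ∎
  where
  swap : ∀ x y z → x * (y * z) ≡ y * (x * z)
  swap = solve-∀

∏<-telescope-+ : ∀ (a b w : ℕ → ℤ) → (∀ i → a i * w (suc i) ≡ b i * w i) →
                 ∀ d e → ∏< (d ℕ.+ e) a * w d ≡ (∏< e (λ i → a (d ℕ.+ i)) * ∏< d b) * w 0
∏<-telescope-+ a b w step d e = begin
  ∏< (d ℕ.+ e) a * w d    ≡⟨ cong (_* w d) (∏<-+ d e a) ⟩
  (∏< d a * rest) * w d   ≡⟨ swap (∏< d a) rest (w d) ⟩
  rest * (∏< d a * w d)   ≡⟨ cong (rest *_) (∏<-telescope a b w step d) ⟩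
  rest * (∏< d b * w 0)   ≡⟨ ℤ.*-assoc rest (∏< d b) (w 0) ⟨
  (rest * ∏< d b) * w 0   ∎
  where
  rest = ∏< e (λ i → a (d ℕ.+ i))
  swap : ∀ p q w → (p * q) * w ≡ q * (p * w)
  swap = solve-∀

-- Binomial coefficients with an integer lower index

choose : ℕ → ℤ → ℤ
choose m (+ k)    = + (m C k)
choose m -[1+ _ ] = + 0

+a-+b≡-[1+b∸1+a] : ∀ {a b} → a < b → + a - + b ≡ -[1+ b ∸ suc a ]
+a-+b≡-[1+b∸1+a] {zero}  {suc b} _         = refl
+a-+b≡-[1+b∸1+a] {suc a} {suc b} (s≤s a<b) = trans (cancel (+ a) (+ b)) (+a-+b≡-[1+b∸1+a] a<b)
  where
  cancel : ∀ a b → (+ 1 + a) - (+ 1 + b) ≡ a - b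
  cancel = solve-∀

choose-above : ∀ m {k} → m < k → choose m (+ k) ≡ + 0
choose-above m m<k = cong +_ (k>n⇒nCk≡0 m<k)

choose-below : ∀ m {a b} → a < b → choose m (+ a - + b) ≡ + 0
choose-below m a<b = cong (choose m) (+a-+b≡-[1+b∸1+a] a<b)

choose-pascal : ∀ m t → choose (suc m) t ≡ choose m t + choose m (t - + 1)
choose-pascal m (+ zero)  = refl
choose-pascal m (+ suc k) = begin
  + (suc m C suc k)                        ≡⟨ cong +_ (nCk+nC[k+1]≡[n+1]C[k+1] m k) ⟨
  + (m C k ℕ.+ m C suc k)                  ≡⟨ cong +_ (ℕ.+-comm (m C k) _) ⟩
  + (m C suc k) + + (m C k)                ≡⟨ cong (λ t → + (m C suc k) + choose m t) (predecessor (+ k)) ⟨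
  + (m C suc k) + choose m (+ suc k - + 1) ∎
  where
  predecessor : ∀ k → (+ 1 + k) - + 1 ≡ k
  predecessor = solve-∀
choose-pascal m -[1+ k ]  = refl

choose-reflect : ∀ m t → choose m (+ m - t) ≡ choose m t
choose-reflect m (+ a) with ℕ.≤-<-connex a m
... | inj₁ a≤m = trans (cong (choose m) (trans (ℤ.m-n≡m⊖n m a) (ℤ.⊖-≥ a≤m))) (cong +_ (sym (nCk≡nC[n∸k] a≤m)))
... | inj₂ m<a = trans (choose-below m m<a) (sym (choose-above m m<a))
choose-reflect m -[1+ a ] = choose-above m (ℕ.m<m+n m (s≤s z≤n))

choose-sym : ∀ m s t → s + t ≡ + m → choose m s ≡ choose m t
choose-sym m s t s+t≡m = begin
  choose m s           ≡⟨ choose-reflect m s ⟨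
  choose m (+ m - s)   ≡⟨ cong (λ x → choose m (x - s)) s+t≡m ⟨
  choose m (s + t - s) ≡⟨ cong (choose m) (cancel s t) ⟩
  choose m t           ∎
  where
  cancel : ∀ s t → s + t - s ≡ t
  cancel = solve-∀

vandermonde : ∀ m n k → ∑< (suc m) (λ j → choose m (+ j) * choose n (k - + j)) ≡ choose (m ℕ.+ n) k
vandermonde zero    n k = trans (ℤ.+-identityʳ _) (trans (ℤ.*-identityˡ _) (cong (choose n) (ℤ.+-identityʳ k)))
vandermonde (suc m) n k = begin
  ∑< (suc (suc m)) (λ j → choose (suc m) (+ j) * c (k - + j))
    ≡⟨ ∑<-cong (suc (suc m)) {g = λ j → lower j + upper j} pascal ⟩
  ∑< (suc (suc m)) (λ j → lower j + upper j)
    ≡⟨ ∑<-distrib-+ (suc (suc m)) lower upper ⟩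
  ∑< (suc (suc m)) lower + ∑< (suc (suc m)) upper
    ≡⟨ cong₂ _+_ ∑lower ∑upper ⟩
  choose (m ℕ.+ n) k + choose (m ℕ.+ n) (k - + 1)
    ≡⟨ choose-pascal (m ℕ.+ n) k ⟨
  choose (suc m ℕ.+ n) k ∎
  where
  c = choose n
  lower upper : ℕ → ℤ
  lower j = choose m (+ j) * c (k - + j)
  upper j = choose m (+ j - + 1) * c (k - + j)
  pascal : ∀ j → j < suc (suc m) → choose (suc m) (+ j) * c (k - + j) ≡ lower j + upper j
  pascal j _ = trans (cong (_* c (k - + j)) (choose-pascal m (+ j))) (ℤ.*-distribʳ-+ (c (k - + j)) (choose m (+ j)) (choose m (+ j - + 1)))
  ∑lower : ∑< (suc (suc m)) lower ≡ choose (m ℕ.+ n) k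
  ∑lower = begin
    ∑< (suc (suc m)) lower           ≡⟨ ∑<-suc (suc m) lower ⟩
    ∑< (suc m) lower + lower (suc m) ≡⟨ cong₂ _+_ (vandermonde m n k) (cong (_* c (k - + suc m)) (choose-above m (ℕ.n<1+n m))) ⟩
    choose (m ℕ.+ n) k + + 0         ≡⟨ ℤ.+-identityʳ _ ⟩
    choose (m ℕ.+ n) k               ∎
  shift : ∀ k j → k - (+ 1 + j) ≡ (k - + 1) - j
  shift = solve-∀
  ∑upper : ∑< (suc (suc m)) upper ≡ choose (m ℕ.+ n) (k - + 1)
  ∑upper = begin
    ∑< (suc (suc m)) upper
      ≡⟨ ℤ.+-identityˡ _ ⟩
    ∑< (suc m) (λ j → choose m (+ j) * c (k - + suc j))
      ≡⟨ ∑<-cong (suc m) (λ j _ → cong (λ x → choose m (+ j) * c x) (shift k (+ j))) ⟩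
    ∑< (suc m) (λ j → choose m (+ j) * c ((k - + 1) - + j))
      ≡⟨ vandermonde m n (k - + 1) ⟩
    choose (m ℕ.+ n) (k - + 1) ∎

offCentre : ℕ → ℕ → ℤ
offCentre m d = + ((m ℕ.+ m) C (m ℕ.+ d))

choose-correlation : ∀ m a d L → a ℕ.+ m < L →
  ∑< L (λ j → choose m (+ j - + a) * choose m (+ j - + (a ℕ.+ d))) ≡ offCentre m d
choose-correlation m zero d L m<L with ℕ.m≤n⇒∃[o]m+o≡n m<L
... | e , refl = begin
  ∑< (suc m ℕ.+ e) f                                                  ≡⟨ ∑<-truncate (suc m) e f vanish ⟩
  ∑< (suc m) f                                                        ≡⟨ ∑<-cong (suc m) {f} reflected ⟩
  ∑< (suc m) (λ j → choose m (+ j) * choose m (+ (m ℕ.+ d) - + j))    ≡⟨ vandermonde m m (+ (m ℕ.+ d)) ⟩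
  offCentre m d                                                       ∎
  where
  f : ℕ → ℤ
  f j = choose m (+ j - + 0) * choose m (+ j - + d)
  vanish : ∀ j → suc m ≤ j → f j ≡ + 0
  vanish j m<j = begin
    choose m (+ j - + 0) * choose m (+ j - + d) ≡⟨ cong (λ x → choose m x * choose m (+ j - + d)) (ℤ.+-identityʳ (+ j)) ⟩
    choose m (+ j) * choose m (+ j - + d)       ≡⟨ cong (_* choose m (+ j - + d)) (choose-above m m<j) ⟩
    + 0                                         ∎
  complement : ∀ j m d → (j - d) + ((m + d) - j) ≡ m
  complement = solve-∀
  reflected : ∀ j → j < suc m → f j ≡ choose m (+ j) * choose m (+ (m ℕ.+ d) - + j)
  reflected j _ = cong₂ _*_ (cong (choose m) (ℤ.+-identityʳ (+ j)))
                            (choose-sym m (+ j - + d) (+ (m ℕ.+ d) - + j) (complement (+ j) (+ m) (+ d)))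
choose-correlation m (suc a) d (suc L) (s≤s a+m<L) = begin
  ∑< (suc L) (λ j → choose m (+ j - + suc a) * choose m (+ j - + suc (a ℕ.+ d)))
    ≡⟨ ℤ.+-identityˡ _ ⟩
  ∑< L (λ j → choose m (+ suc j - + suc a) * choose m (+ suc j - + suc (a ℕ.+ d)))
    ≡⟨ ∑<-cong L (λ j _ → cong₂ (λ x y → choose m x * choose m y) (cancel (+ j) (+ a)) (cancel (+ j) (+ (a ℕ.+ d)))) ⟩
  ∑< L (λ j → choose m (+ j - + a) * choose m (+ j - + (a ℕ.+ d)))
    ≡⟨ choose-correlation m a d L a+m<L ⟩
  offCentre m d ∎
  where
  cancel : ∀ j a → (+ 1 + j) - (+ 1 + a) ≡ j - a
  cancel = solve-∀

[k+1]*nC[k+1]+k*nCk≡n*nCk : ∀ n k → suc k ℕ.* (n C suc k) ℕ.+ k ℕ.* (n C k) ≡ n ℕ.* (n C k)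
[k+1]*nC[k+1]+k*nCk≡n*nCk zero    zero    = refl
[k+1]*nC[k+1]+k*nCk≡n*nCk zero    (suc k) = cong₂ ℕ._+_ (ℕ.*-zeroʳ (suc (suc k))) (ℕ.*-zeroʳ (suc k))
[k+1]*nC[k+1]+k*nCk≡n*nCk (suc n) zero    =
  trans (ℕ.+-identityʳ _) (trans (ℕ.*-identityˡ _) (trans (nC1≡n (suc n)) (sym (ℕ.*-identityʳ (suc n)))))
[k+1]*nC[k+1]+k*nCk≡n*nCk (suc n) (suc k) = begin
  suc (suc k) ℕ.* (suc n C suc (suc k)) ℕ.+ suc k ℕ.* (suc n C suc k)
    ≡⟨ cong₂ (λ x y → suc (suc k) ℕ.* x ℕ.+ suc k ℕ.* y) (pascal (suc k)) (pascal k) ⟩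
  suc (suc k) ℕ.* (c₁ ℕ.+ c₂) ℕ.+ suc k ℕ.* (c₀ ℕ.+ c₁)
    ≡⟨ regroup k c₀ c₁ c₂ ⟩
  (suc (suc k) ℕ.* c₂ ℕ.+ suc k ℕ.* c₁) ℕ.+ (suc k ℕ.* c₁ ℕ.+ k ℕ.* c₀) ℕ.+ (c₀ ℕ.+ c₁)
    ≡⟨ cong₂ (λ x y → x ℕ.+ y ℕ.+ (c₀ ℕ.+ c₁)) ([k+1]*nC[k+1]+k*nCk≡n*nCk n (suc k)) ([k+1]*nC[k+1]+k*nCk≡n*nCk n k) ⟩
  n ℕ.* c₁ ℕ.+ n ℕ.* c₀ ℕ.+ (c₀ ℕ.+ c₁)
    ≡⟨ collect n c₀ c₁ ⟩
  suc n ℕ.* (c₀ ℕ.+ c₁)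
    ≡⟨ cong (suc n ℕ.*_) (pascal k) ⟨
  suc n ℕ.* (suc n C suc k) ∎
  where
  c₀ = n C k
  c₁ = n C suc k
  c₂ = n C suc (suc k)
  pascal : ∀ j → suc n C suc j ≡ n C j ℕ.+ n C suc j
  pascal j = sym (nCk+nC[k+1]≡[n+1]C[k+1] n j)
  regroup : ∀ k c₀ c₁ c₂ → suc (suc k) ℕ.* (c₁ ℕ.+ c₂) ℕ.+ suc k ℕ.* (c₀ ℕ.+ c₁)
          ≡ (suc (suc k) ℕ.* c₂ ℕ.+ suc k ℕ.* c₁) ℕ.+ (suc k ℕ.* c₁ ℕ.+ k ℕ.* c₀) ℕ.+ (c₀ ℕ.+ c₁)
  regroup = ℕ-Solver.solve-∀
  collect : ∀ n c₀ c₁ → n ℕ.* c₁ ℕ.+ n ℕ.* c₀ ℕ.+ (c₀ ℕ.+ c₁) ≡ suc n ℕ.* (c₀ ℕ.+ c₁)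
  collect = ℕ-Solver.solve-∀

[k+1]*nC[k+1]≡[n-k]*nCk : ∀ n k → + suc k * + (n C suc k) ≡ (+ n - + k) * + (n C k)
[k+1]*nC[k+1]≡[n-k]*nCk n k = begin
  + suc k * + (n C suc k)                                       ≡⟨ isolate (+ suc k * + (n C suc k)) (+ k * + (n C k)) ⟩
  (+ suc k * + (n C suc k) + + k * + (n C k)) - + k * + (n C k) ≡⟨ cong (λ x → x - + k * + (n C k)) cast ⟩
  + n * + (n C k) - + k * + (n C k)                             ≡⟨ factor (+ n) (+ k) (+ (n C k)) ⟩
  (+ n - + k) * + (n C k)                                       ∎
  where
  cast : + suc k * + (n C suc k) + + k * + (n C k) ≡ + n * + (n C k)
  cast = begin
    + suc k * + (n C suc k) + + k * + (n C k)     ≡⟨ cong₂ _+_ (ℤ.pos-* (suc k) _) (ℤ.pos-* k _) ⟨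
    + (suc k ℕ.* (n C suc k)) + + (k ℕ.* (n C k)) ≡⟨ cong +_ ([k+1]*nC[k+1]+k*nCk≡n*nCk n k) ⟩
    + (n ℕ.* (n C k))                             ≡⟨ ℤ.pos-* n _ ⟩
    + n * + (n C k)                               ∎
  isolate : ∀ x y → x ≡ (x + y) - y
  isolate = solve-∀
  factor : ∀ n k c → n * c - k * c ≡ (n - k) * c
  factor = solve-∀

offCentre-step : ∀ m d → (+ m + + suc d) * offCentre m (suc d) ≡ (+ m - + d) * offCentre m d
offCentre-step m d rewrite ℕ.+-suc m d =
  trans ([k+1]*nC[k+1]≡[n-k]*nCk (m ℕ.+ m) (m ℕ.+ d)) (cong (_* offCentre m d) (cancel (+ m) (+ d)))
  where
  cancel : ∀ m d → (m + m) - (m + d) ≡ m - d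
  cancel = solve-∀

centralBinomial : ℕ → ℤ
centralBinomial M = + ((M ℕ.+ M) C M)

centralBinomial-suc : ∀ M → + suc M * centralBinomial (suc M) ≡ (+ 4 * + M + + 2) * centralBinomial M
centralBinomial-suc M = begin
  + suc M * + ((suc M ℕ.+ suc M) C suc M)                   ≡⟨ cong (λ c → + suc M * + c) doubling ⟩
  + suc M * (+ (X ℕ.+ Y) + + (X ℕ.+ Y))                     ≡⟨ expand (+ suc M) (+ X) (+ Y) ⟩
  + 2 * (+ suc M * + Y) + + 2 * + suc M * + X               ≡⟨ cong (λ t → + 2 * t + + 2 * + suc M * + X) ([k+1]*nC[k+1]≡[n-k]*nCk (M ℕ.+ M) M) ⟩
  + 2 * ((+ M + + M - + M) * + X) + + 2 * (+ 1 + + M) * + X ≡⟨ collect (+ M) (+ X) ⟩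
  (+ 4 * + M + + 2) * + X                                   ∎
  where
  X = (M ℕ.+ M) C M
  Y = (M ℕ.+ M) C suc M
  pascal : ∀ n k → suc n C suc k ≡ n C k ℕ.+ n C suc k
  pascal n k = sym (nCk+nC[k+1]≡[n+1]C[k+1] n k)
  symmetric : suc (M ℕ.+ M) C M ≡ suc (M ℕ.+ M) C suc M
  symmetric = trans (nCk≡nC[n∸k] (ℕ.m≤n⇒m≤1+n (ℕ.m≤m+n M M)))
                    (cong (suc (M ℕ.+ M) C_) (trans (cong (_∸ M) (sym (ℕ.+-suc M M))) (ℕ.m+n∸m≡n M (suc M))))
  doubling : (suc M ℕ.+ suc M) C suc M ≡ (X ℕ.+ Y) ℕ.+ (X ℕ.+ Y)
  doubling = begin
    (suc M ℕ.+ suc M) C suc M                       ≡⟨ cong (λ n → suc n C suc M) (ℕ.+-suc M M) ⟩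
    suc (suc (M ℕ.+ M)) C suc M                     ≡⟨ pascal (suc (M ℕ.+ M)) M ⟩
    suc (M ℕ.+ M) C M ℕ.+ suc (M ℕ.+ M) C suc M     ≡⟨ cong (ℕ._+ suc (M ℕ.+ M) C suc M) symmetric ⟩
    suc (M ℕ.+ M) C suc M ℕ.+ suc (M ℕ.+ M) C suc M ≡⟨ cong₂ ℕ._+_ (pascal (M ℕ.+ M) M) (pascal (M ℕ.+ M) M) ⟩
    (X ℕ.+ Y) ℕ.+ (X ℕ.+ Y)                         ∎
  expand : ∀ s x y → s * ((x + y) + (x + y)) ≡ + 2 * (s * y) + + 2 * s * x
  expand = solve-∀
  collect : ∀ m x → + 2 * ((m + m - m) * x) + + 2 * (+ 1 + m) * x ≡ (+ 4 * m + + 2) * x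
  collect = solve-∀

centralBinomial-step : ∀ m d →
  (+ m + + suc d) * centralBinomial (m ℕ.+ suc d) ≡ (+ 4 * (+ m + + d) + + 2) * centralBinomial (m ℕ.+ d)
centralBinomial-step m d rewrite ℕ.+-suc m d = centralBinomial-suc (m ℕ.+ d)

-- The Murnaghan–Nakayama rule on beta-sets with two beads

≡ᵇ-true : ∀ {m n} → m ≡ n → (m ≡ᵇ n) ≡ true
≡ᵇ-true {m} {n} = dec-true (m ℕ.≟ n)

≡ᵇ-false : ∀ {m n} → m ≢ n → (m ≡ᵇ n) ≡ false
≡ᵇ-false {m} {n} = dec-false (m ℕ.≟ n)

<ᵇ-true : ∀ {m n} → m < n → (m <ᵇ n) ≡ true
<ᵇ-true {m} {n} = dec-true ((m <ᵇ n) because ℕ.<ᵇ-reflects-< m n)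

<ᵇ-false : ∀ {m n} → ¬ m < n → (m <ᵇ n) ≡ false
<ᵇ-false {m} {n} = dec-false ((m <ᵇ n) because ℕ.<ᵇ-reflects-< m n)

≤ᵇ-true : ∀ {m n} → m ≤ n → (m ≤ᵇ n) ≡ true
≤ᵇ-true {m} {n} = dec-true (m ℕ.≤? n)

≤ᵇ-false : ∀ {m n} → ¬ m ≤ n → (m ≤ᵇ n) ≡ false
≤ᵇ-false {m} {n} = dec-false (m ℕ.≤? n)

m<1+n+m : ∀ m n → m < suc n ℕ.+ m
m<1+n+m m n = ℕ.m<n+m m (s≤s z≤n)

+[a+b]-+a≡+b : ∀ a b → + (a ℕ.+ b) - + a ≡ + b
+[a+b]-+a≡+b a b = cancel (+ a) (+ b)
  where
  cancel : ∀ a b → a + b - a ≡ b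
  cancel = solve-∀

-- The summand of mnβ β (k ∷ μ) for the bead b, i.e. the where-bound term of Defs.mnβ.
hookTerm : List ℕ → ℕ → List ℕ → ℕ → ℤ
hookTerm β k μ b =
  if (k ≤ᵇ b) ∧ not ((b ∸ k) ∈ᵇ β)
  then signℤ (length (filterᵇ (λ x → ((b ∸ k) <ᵇ x) ∧ (x <ᵇ b)) β))
         ℤ.* mnβ (map (λ x → if x ≡ᵇ b then b ∸ k else x) β) μ
  else + 0

mnβ-pair : ∀ x y k μ → mnβ (x ∷ y ∷ []) (k ∷ μ) ≡ hookTerm (x ∷ y ∷ []) k μ x + hookTerm (x ∷ y ∷ []) k μ y
mnβ-pair x y k μ = cong (_+_ (hookTerm (x ∷ y ∷ []) k μ x)) (ℤ.+-identityʳ _)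

mnβ-singleton-hook : ∀ k t μ → mnβ (suc k ℕ.+ t ∷ []) (suc k ∷ μ) ≡ mnβ (t ∷ []) μ
mnβ-singleton-hook k t μ
  rewrite ≤ᵇ-true (ℕ.m≤m+n (suc k) t) | ℕ.m+n∸m≡n (suc k) t
        | ≡ᵇ-false (ℕ.>⇒≢ (m<1+n+m t k)) | <ᵇ-true (m<1+n+m t k)
        | <ᵇ-false (ℕ.n≮n (k ℕ.+ t)) | ≡ᵇ-true {k ℕ.+ t} refl
  = trans (ℤ.+-identityʳ _) (ℤ.*-identityˡ _)

mnβ-singleton-ones : ∀ m → mnβ (m ∷ []) (ones m) ≡ + 1
mnβ-singleton-ones zero    = refl
mnβ-singleton-ones (suc m) = trans (mnβ-singleton-hook 0 m (ones m)) (mnβ-singleton-ones m)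

sgn : ℕ → ℕ → ℤ
sgn zero    zero    = + 0
sgn zero    (suc _) = -[1+ 0 ]
sgn (suc _) zero    = + 1
sgn (suc x) (suc y) = sgn x y

sgn-> : ∀ {x y} → y < x → sgn x y ≡ + 1
sgn-> {suc x} {zero}  _         = refl
sgn-> {suc x} {suc y} (s≤s y<x) = sgn-> y<x

sgn-< : ∀ {x y} → x < y → sgn x y ≡ -[1+ 0 ]
sgn-< {zero}  {suc y} _         = refl
sgn-< {suc x} {suc y} (s≤s x<y) = sgn-< x<y

sgn-≡ : ∀ x → sgn x x ≡ + 0
sgn-≡ zero    = refl
sgn-≡ (suc x) = sgn-≡ x

-- mnβ does not see the order of the beads; weighting it by the sign of x - y makes it
-- alternating in (x, y), and then the rule takes the determinantal form of
-- alternant-hook, with a bead pushed below 0 contributing nothing.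
alternant : ℤ → ℤ → List ℕ → ℤ
alternant (+ x)    (+ y)    μ = sgn x y * mnβ (x ∷ y ∷ []) μ
alternant (+ _)    -[1+ _ ] μ = + 0
alternant -[1+ _ ] _        μ = + 0

alternant-≡ : ∀ x μ → alternant (+ x) (+ x) μ ≡ + 0
alternant-≡ x μ = cong (_* mnβ (x ∷ x ∷ []) μ) (sgn-≡ x)

-- The leg sign of a hook term is -1 exactly when the other bead lies strictly between the
-- old and the new position of the moved bead, i.e. exactly when the move changes sgn.
hook-top : ∀ x y k μ → x ≢ y →
  sgn x y * hookTerm (x ∷ y ∷ []) (suc k) μ x ≡ alternant (+ x - + suc k) (+ y) μ
hook-top x y k μ x≢y with suc k ℕ.≤? x
... | no x≱1+k rewrite ≤ᵇ-false x≱1+k | +a-+b≡-[1+b∸1+a] (ℕ.≰⇒> x≱1+k) = ℤ.*-zeroʳ (sgn x y)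
... | yes 1+k≤x with ℕ.m≤n⇒∃[o]m+o≡n 1+k≤x
...   | t , refl
  rewrite ≤ᵇ-true 1+k≤x | ℕ.m+n∸m≡n (suc k) t | +[a+b]-+a≡+b (suc k) t
        | ≡ᵇ-false (ℕ.>⇒≢ (m<1+n+m t k)) | <ᵇ-true (m<1+n+m t k) | <ᵇ-false (ℕ.n≮n (k ℕ.+ t))
        | ≡ᵇ-true {k ℕ.+ t} refl | ≡ᵇ-false (x≢y ∘ sym)
        with ℕ.<-cmp t y
... | tri≈ _ refl _ rewrite ≡ᵇ-true {t} refl = trans (ℤ.*-zeroʳ (sgn (suc k ℕ.+ t) t)) (sym (alternant-≡ t μ))
... | tri> _ _ y<t
  rewrite ≡ᵇ-false (ℕ.<⇒≢ y<t) | <ᵇ-false (ℕ.<⇒≯ y<t) | sgn-> y<t | sgn-> (ℕ.<-≤-trans y<t (ℕ.m≤n+m t (suc k)))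
  = ℤ.*-identityˡ _
... | tri< t<y _ _ rewrite ≡ᵇ-false (ℕ.>⇒≢ t<y) | <ᵇ-true t<y | sgn-< t<y with ℕ.<-cmp y (suc k ℕ.+ t)
...   | tri< y<x _ _ rewrite <ᵇ-true y<x | sgn-> y<x = ℤ.*-identityˡ _
...   | tri≈ _ y≡x _ = contradiction (sym y≡x) x≢y
...   | tri> _ _ x<y rewrite <ᵇ-false (ℕ.<⇒≯ x<y) | sgn-< x<y = cong (-[1+ 0 ] *_) (ℤ.*-identityˡ _)

hook-bottom : ∀ x y k μ → x ≢ y →
  sgn x y * hookTerm (x ∷ y ∷ []) (suc k) μ y ≡ alternant (+ x) (+ y - + suc k) μ
hook-bottom x y k μ x≢y with suc k ℕ.≤? y
... | no y≱1+k rewrite ≤ᵇ-false y≱1+k | +a-+b≡-[1+b∸1+a] (ℕ.≰⇒> y≱1+k) = ℤ.*-zeroʳ (sgn x y)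
... | yes 1+k≤y with ℕ.m≤n⇒∃[o]m+o≡n 1+k≤y
...   | t , refl
  rewrite ≤ᵇ-true 1+k≤y | ℕ.m+n∸m≡n (suc k) t | +[a+b]-+a≡+b (suc k) t
        | ≡ᵇ-false (ℕ.>⇒≢ (m<1+n+m t k)) | ≡ᵇ-true {k ℕ.+ t} refl | ≡ᵇ-false x≢y
        with ℕ.<-cmp x t
... | tri≈ _ refl _ rewrite ≡ᵇ-true {x} refl = trans (ℤ.*-zeroʳ (sgn x (suc k ℕ.+ x))) (sym (alternant-≡ x μ))
... | tri< x<t _ _
  rewrite ≡ᵇ-false (ℕ.<⇒≢ x<t) | <ᵇ-false (ℕ.<⇒≯ x<t) | <ᵇ-true (m<1+n+m t k) | <ᵇ-false (ℕ.n≮n (k ℕ.+ t))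
        | sgn-< x<t | sgn-< (ℕ.<-≤-trans x<t (ℕ.m≤n+m t (suc k)))
  = cong (-[1+ 0 ] *_) (ℤ.*-identityˡ _)
... | tri> _ _ t<x rewrite ≡ᵇ-false (ℕ.>⇒≢ t<x) | <ᵇ-true t<x | sgn-> t<x with ℕ.<-cmp x (suc k ℕ.+ t)
...   | tri≈ _ x≡y _ = contradiction x≡y x≢y
...   | tri> _ _ y<x
  rewrite <ᵇ-false (ℕ.<⇒≯ y<x) | <ᵇ-true (m<1+n+m t k) | <ᵇ-false (ℕ.n≮n (k ℕ.+ t)) | sgn-> y<x
  = ℤ.*-identityˡ _
...   | tri< x<y _ _
  rewrite <ᵇ-true x<y | <ᵇ-true (m<1+n+m t k) | <ᵇ-false (ℕ.n≮n (k ℕ.+ t)) | sgn-< x<y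
  = negate-twice _
  where
  negate-twice : ∀ a → - + 1 * (- + 1 * a) ≡ + 1 * a
  negate-twice = solve-∀

alternant-hook : ∀ x y k μ → x ≢ y →
  alternant (+ x) (+ y) (suc k ∷ μ) ≡ alternant (+ x - + suc k) (+ y) μ + alternant (+ x) (+ y - + suc k) μ
alternant-hook x y k μ x≢y = begin
  sgn x y * mnβ (x ∷ y ∷ []) (suc k ∷ μ)
    ≡⟨ cong (sgn x y *_) (mnβ-pair x y (suc k) μ) ⟩
  sgn x y * (hookTerm (x ∷ y ∷ []) (suc k) μ x + hookTerm (x ∷ y ∷ []) (suc k) μ y)
    ≡⟨ ℤ.*-distribˡ-+ (sgn x y) _ _ ⟩
  sgn x y * hookTerm (x ∷ y ∷ []) (suc k) μ x + sgn x y * hookTerm (x ∷ y ∷ []) (suc k) μ y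
    ≡⟨ cong₂ _+_ (hook-top x y k μ x≢y) (hook-bottom x y k μ x≢y) ⟩
  alternant (+ x - + suc k) (+ y) μ + alternant (+ x) (+ y - + suc k) μ ∎

y≡[x+y]-x : ∀ x y → y ≡ (x + y) - x
y≡[x+y]-x = solve-∀

alternant-ones : ∀ m x y → x + y ≡ + suc m → alternant x y (ones m) ≡ choose m y - choose m x
alternant-ones m -[1+ a ] y x+y≡1+m =
  sym (cong (_- + 0) (trans (cong (choose m) y≡) (choose-above m (s≤s (ℕ.m≤m+n m (suc a))))))
  where
  y≡ : y ≡ + (suc m ℕ.+ suc a)
  y≡ = trans (y≡[x+y]-x -[1+ a ] y) (cong (_- -[1+ a ]) x+y≡1+m)
alternant-ones m (+ a) -[1+ b ] x+y≡1+m =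
  sym (cong (_-_ (+ 0)) (trans (cong (choose m) x≡) (choose-above m (s≤s (ℕ.m≤m+n m (suc b))))))
  where
  x≡ : + a ≡ + (suc m ℕ.+ suc b)
  x≡ = trans (y≡[x+y]-x -[1+ b ] (+ a)) (cong (_- -[1+ b ]) (trans (ℤ.+-comm -[1+ b ] (+ a)) x+y≡1+m))
alternant-ones m (+ a) (+ b) x+y≡1+m with a ℕ.≟ b
... | yes refl = trans (alternant-≡ a (ones m)) (sym (ℤ.+-inverseʳ (choose m (+ a))))
alternant-ones zero    (+ 0)           (+ 1)           _  | no _ = refl
alternant-ones zero    (+ 1)           (+ 0)           _  | no _ = refl
alternant-ones zero    (+ 0)           (+ 0)           () | no _
alternant-ones zero    (+ 0)           (+ suc (suc b)) () | no _
alternant-ones zero    (+ suc zero)    (+ suc b)       () | no _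
alternant-ones zero    (+ suc (suc a)) (+ b)           () | no _
alternant-ones (suc m) (+ a)           (+ b) a+b≡2+m      | no a≢b = begin
  alternant (+ a) (+ b) (1 ∷ ones m)
    ≡⟨ alternant-hook a b 0 (ones m) a≢b ⟩
  alternant (+ a - + 1) (+ b) (ones m) + alternant (+ a) (+ b - + 1) (ones m)
    ≡⟨ cong₂ _+_ (alternant-ones m (+ a - + 1) (+ b) (trans (lower-left (+ a) (+ b)) (cong (_- + 1) a+b≡2+m)))
                 (alternant-ones m (+ a) (+ b - + 1) (trans (lower-right (+ a) (+ b)) (cong (_- + 1) a+b≡2+m))) ⟩
  (choose m (+ b) - choose m (+ a - + 1)) + (choose m (+ b - + 1) - choose m (+ a))
    ≡⟨ regroup (choose m (+ b)) (choose m (+ a - + 1)) (choose m (+ b - + 1)) (choose m (+ a)) ⟩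
  (choose m (+ b) + choose m (+ b - + 1)) - (choose m (+ a) + choose m (+ a - + 1))
    ≡⟨ cong₂ _-_ (choose-pascal m (+ b)) (choose-pascal m (+ a)) ⟨
  choose (suc m) (+ b) - choose (suc m) (+ a) ∎
  where
  lower-left : ∀ x y → (x - + 1) + y ≡ (x + y) - + 1
  lower-left = solve-∀
  lower-right : ∀ x y → x + (y - + 1) ≡ (x + y) - + 1
  lower-right = solve-∀
  regroup : ∀ b a₁ b₁ a → (b - a₁) + (b₁ - a) ≡ (b + b₁) - (a + a₁)
  regroup = solve-∀

twoRowChar : ℕ → ℤ → ℤ
twoRowChar m t = choose m t - choose m (t - + 1) + choose m (t - + 5) - choose m (t - + 6)

alternant-fiveOnes : ∀ m a b → a ≢ b → + a + + b ≡ + (6 ℕ.+ m) →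
  alternant (+ a) (+ b) (5 ∷ ones m) ≡ twoRowChar m (+ b)
alternant-fiveOnes m a b a≢b a+b≡6+m = begin
  alternant (+ a) (+ b) (5 ∷ ones m)
    ≡⟨ alternant-hook a b 4 (ones m) a≢b ⟩
  alternant (+ a - + 5) (+ b) (ones m) + alternant (+ a) (+ b - + 5) (ones m)
    ≡⟨ cong₂ _+_ (alternant-ones m (+ a - + 5) (+ b) (trans (lower-left (+ a) (+ b)) (cong (_- + 5) a+b≡6+m)))
                 (alternant-ones m (+ a) (+ b - + 5) (trans (lower-right (+ a) (+ b)) (cong (_- + 5) a+b≡6+m))) ⟩
  (choose m (+ b) - choose m (+ a - + 5)) + (choose m (+ b - + 5) - choose m (+ a))
    ≡⟨ cong₂ (λ u v → (choose m (+ b) - u) + (choose m (+ b - + 5) - v))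
             (choose-sym m (+ a - + 5) (+ b - + 1) (trans (reflect₁ (+ a) (+ b)) (cong (_- + 6) a+b≡6+m)))
             (choose-sym m (+ a) (+ b - + 6) (trans (reflect₆ (+ a) (+ b)) (cong (_- + 6) a+b≡6+m))) ⟩
  (choose m (+ b) - choose m (+ b - + 1)) + (choose m (+ b - + 5) - choose m (+ b - + 6))
    ≡⟨ regroup (choose m (+ b)) (choose m (+ b - + 1)) (choose m (+ b - + 5)) (choose m (+ b - + 6)) ⟩
  twoRowChar m (+ b) ∎
  where
  lower-left : ∀ x y → (x - + 5) + y ≡ (x + y) - + 5
  lower-left = solve-∀
  lower-right : ∀ x y → x + (y - + 5) ≡ (x + y) - + 5
  lower-right = solve-∀
  reflect₁ : ∀ x y → (x - + 5) + (y - + 1) ≡ (x + y) - + 6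
  reflect₁ = solve-∀
  reflect₆ : ∀ x y → x + (y - + 6) ≡ (x + y) - + 6
  reflect₆ = solve-∀
  regroup : ∀ c₀ c₁ c₅ c₆ → (c₀ - c₁) + (c₅ - c₆) ≡ c₀ - c₁ + c₅ - c₆
  regroup = solve-∀

χ-twoRow-fiveOnes : ∀ m j → j ℕ.+ j ≤ 5 ℕ.+ m → χ (twoRow (5 ℕ.+ m) j) (fiveOnes (5 ℕ.+ m)) ≡ twoRowChar m (+ j)
χ-twoRow-fiveOnes m zero    _     rewrite ℕ.+-identityʳ m = trans (mnβ-singleton-hook 4 m (ones m)) (mnβ-singleton-ones m)
χ-twoRow-fiveOnes m (suc i) j+j≤n rewrite ℕ.+-identityʳ i = begin
  mnβ (a ∷ j ∷ []) (5 ∷ ones m)       ≡⟨ ℤ.*-identityˡ _ ⟨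
  + 1 * mnβ (a ∷ j ∷ []) (5 ∷ ones m) ≡⟨ cong (_* mnβ (a ∷ j ∷ []) (5 ∷ ones m)) (sgn-> j<a) ⟨
  alternant (+ a) (+ j) (5 ∷ ones m)  ≡⟨ alternant-fiveOnes m a j (ℕ.>⇒≢ j<a) (cong +_ a+j≡6+m) ⟩
  twoRowChar m (+ j)                  ∎
  where
  n = 5 ℕ.+ m
  j = suc i
  a = (n ∸ j) ℕ.+ 1
  j<a : j < a
  j<a = subst (j <_) (ℕ.+-comm 1 (n ∸ j)) (s≤s (ℕ.m+n≤o⇒m≤o∸n j j+j≤n))
  a+j≡6+m : a ℕ.+ j ≡ 6 ℕ.+ m
  a+j≡6+m = begin
    n ∸ j ℕ.+ 1 ℕ.+ j ≡⟨ ℕ.+-assoc (n ∸ j) 1 j ⟩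
    n ∸ j ℕ.+ suc j   ≡⟨ ℕ.+-suc (n ∸ j) j ⟩
    suc (n ∸ j ℕ.+ j) ≡⟨ cong suc (ℕ.m∸n+n≡m (ℕ.m+n≤o⇒n≤o j j+j≤n)) ⟩
    suc n             ∎

-- The sum of squares of the character values

twoRowChar-antisym : ∀ m t → twoRowChar m (+ 6 + + m - t) ≡ - twoRowChar m t
twoRowChar-antisym m t = begin
  c s - c (s - + 1) + c (s - + 5) - c (s - + 6)
    ≡⟨ cong₂ _-_ (cong₂ _+_ (cong₂ _-_ (trans (cong c (sym (ℤ.+-identityʳ s))) (mirror 0)) (mirror 1)) (mirror 5)) (mirror 6) ⟩
  c (t - + 6) - c (t - + 5) + c (t - + 1) - c (t - + 0)
    ≡⟨ cong (λ x → c (t - + 6) - c (t - + 5) + c (t - + 1) - c x) (ℤ.+-identityʳ t) ⟩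
  c (t - + 6) - c (t - + 5) + c (t - + 1) - c t
    ≡⟨ negate (c t) (c (t - + 1)) (c (t - + 5)) (c (t - + 6)) ⟩
  - twoRowChar m t ∎
  where
  c = choose m
  s = + 6 + + m - t
  complement : ∀ m t a → (+ 6 + m - t - a) + (t - (+ 6 - a)) ≡ m
  complement = solve-∀
  mirror : ∀ a → c (s - + a) ≡ c (t - (+ 6 - + a))
  mirror a = choose-sym m (s - + a) (t - (+ 6 - + a)) (complement (+ m) t (+ a))
  negate : ∀ c₀ c₁ c₅ c₆ → c₆ - c₅ + c₁ - c₀ ≡ - (c₀ - c₁ + c₅ - c₆)
  negate = solve-∀

twoRowChar² : ℕ → ℕ → ℤ
twoRowChar² m j = twoRowChar m (+ j) * twoRowChar m (+ j)

twoRowChar²-mirror : ∀ m j → j ≤ 6 ℕ.+ m → twoRowChar² m (6 ℕ.+ m ∸ j) ≡ twoRowChar² m j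
twoRowChar²-mirror m j j≤6+m = begin
  twoRowChar m (+ (6 ℕ.+ m ∸ j)) * twoRowChar m (+ (6 ℕ.+ m ∸ j)) ≡⟨ cong (λ t → twoRowChar m t * twoRowChar m t) index ⟩
  twoRowChar m (+ 6 + + m - + j) * twoRowChar m (+ 6 + + m - + j) ≡⟨ cong (λ t → t * t) (twoRowChar-antisym m (+ j)) ⟩
  - twoRowChar m (+ j) * - twoRowChar m (+ j)                     ≡⟨ square-neg (twoRowChar m (+ j)) ⟩
  twoRowChar² m j                                                 ∎
  where
  index : + (6 ℕ.+ m ∸ j) ≡ + 6 + + m - + j
  index = sym (trans (ℤ.m-n≡m⊖n (6 ℕ.+ m) j) (ℤ.⊖-≥ j≤6+m))
  square-neg : ∀ x → - x * - x ≡ x * x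
  square-neg = solve-∀

x≡-x⇒x≡0 : ∀ x → x ≡ - x → x ≡ + 0
x≡-x⇒x≡0 (+ zero)  _  = refl
x≡-x⇒x≡0 (+ suc _) ()
x≡-x⇒x≡0 -[1+ _ ]  ()

twoRowChar-centre : ∀ m c → 6 ℕ.+ m ≡ c ℕ.+ c → twoRowChar m (+ c) ≡ + 0
twoRowChar-centre m c 6+m≡2c = x≡-x⇒x≡0 _ (trans (cong (twoRowChar m) (sym index)) (twoRowChar-antisym m (+ c)))
  where
  cancel : ∀ c → c + c - c ≡ c
  cancel = solve-∀
  index : + 6 + + m - + c ≡ + c
  index = trans (cong (λ x → + x - + c) 6+m≡2c) (cancel (+ c))

n*2≡n+n : ∀ n → n ℕ.* 2 ≡ n ℕ.+ n
n*2≡n+n = ℕ-Solver.solve-∀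

parity : ∀ n → n ≡ n / 2 ℕ.+ n / 2 ⊎ n ≡ suc (n / 2 ℕ.+ n / 2)
parity n with n % 2 | m%n<n n 2 | m≡m%n+[m/n]*n n 2
... | 0           | _            | n≡[n/2]*2   = inj₁ (trans n≡[n/2]*2 (n*2≡n+n (n / 2)))
... | 1           | _            | n≡1+[n/2]*2 = inj₂ (trans n≡1+[n/2]*2 (cong suc (n*2≡n+n (n / 2))))
... | suc (suc _) | s≤s (s≤s ()) | _

[n/2]+[n/2]≤n : ∀ n → n / 2 ℕ.+ n / 2 ≤ n
[n/2]+[n/2]≤n n with parity n
... | inj₁ n≡2k   = ℕ.≤-reflexive (sym n≡2k)
... | inj₂ n≡1+2k = ℕ.≤-trans (ℕ.n≤1+n _) (ℕ.≤-reflexive (sym n≡1+2k))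

∑twoRowChar²-fold : ∀ m → ∑< (7 ℕ.+ m) (twoRowChar² m) ≡ + 2 * ∑< (suc ((5 ℕ.+ m) / 2)) (twoRowChar² m)
∑twoRowChar²-fold m with (5 ℕ.+ m) / 2 | parity (5 ℕ.+ m)
... | k | inj₁ 5+m≡2k = begin
  ∑< (7 ℕ.+ m) F         ≡⟨ cong (λ L → ∑< L F) 7+m≡ ⟩
  ∑< (suc k ℕ.+ suc k) F ≡⟨ ∑<-palindrome-even (suc k) F mirror ⟩
  + 2 * ∑< (suc k) F     ∎
  where
  F = twoRowChar² m
  7+m≡ : 7 ℕ.+ m ≡ suc k ℕ.+ suc k
  7+m≡ = trans (cong (λ x → suc (suc x)) 5+m≡2k) (cong suc (sym (ℕ.+-suc k k)))
  mirror : ∀ i → i < suc k → F (suc k ℕ.+ suc k ∸ suc i) ≡ F i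
  mirror i i<1+k = trans (cong (λ L → F (L ∸ suc i)) (sym 7+m≡))
    (twoRowChar²-mirror m i (ℕ.≤-pred (subst (i <_) (sym 7+m≡) (ℕ.<-≤-trans i<1+k (ℕ.m≤m+n (suc k) (suc k))))))
... | k | inj₂ 5+m≡1+2k = begin
  ∑< (7 ℕ.+ m) F               ≡⟨ cong (λ L → ∑< L F) 7+m≡ ⟩
  ∑< (suc k ℕ.+ suc (suc k)) F ≡⟨ ∑<-palindrome-odd (suc k) F mirror centre ⟩
  + 2 * ∑< (suc k) F           ∎
  where
  F = twoRowChar² m
  6+m≡ : 6 ℕ.+ m ≡ suc k ℕ.+ suc k
  6+m≡ = trans (cong suc 5+m≡1+2k) (cong suc (sym (ℕ.+-suc k k)))
  7+m≡ : 7 ℕ.+ m ≡ suc k ℕ.+ suc (suc k)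
  7+m≡ = trans (cong suc 6+m≡) (sym (ℕ.+-suc (suc k) (suc k)))
  mirror : ∀ i → i < suc k → F (suc k ℕ.+ suc k ∸ i) ≡ F i
  mirror i i<1+k = trans (cong (λ L → F (L ∸ i)) (sym 6+m≡))
    (twoRowChar²-mirror m i (subst (i ≤_) (sym 6+m≡) (ℕ.≤-trans (ℕ.<⇒≤ i<1+k) (ℕ.m≤m+n (suc k) (suc k)))))
  centre : F (suc k) ≡ + 0
  centre = cong (λ x → x * x) (twoRowChar-centre m (suc k) 6+m≡)

∑twoRowChar² : ∀ m → ∑< (7 ℕ.+ m) (twoRowChar² m)
  ≡ + 4 * offCentre m 0 - + 4 * offCentre m 1 + + 4 * offCentre m 5 - + 2 * offCentre m 4 - + 2 * offCentre m 6
∑twoRowChar² m = expansion (7 ℕ.+ m) ℕ.≤-refl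
  where
  x : ℕ → ℕ → ℤ
  x a j = choose m (+ j - + a)
  in-shifts : ∀ j → twoRowChar m (+ j) ≡ x 0 j - x 1 j + x 5 j - x 6 j
  in-shifts j = cong (λ c → c - x 1 j + x 5 j - x 6 j) (cong (choose m) (sym (ℤ.+-identityʳ (+ j))))
  expand : ∀ x₀ x₁ x₅ x₆ → (x₀ - x₁ + x₅ - x₆) * (x₀ - x₁ + x₅ - x₆) ≡
    + 1 * (x₀ * x₀) + (+ 1 * (x₁ * x₁) + (+ 1 * (x₅ * x₅) + (+ 1 * (x₆ * x₆) + (- + 2 * (x₀ * x₁) + (+ 2 * (x₀ * x₅)
      + (- + 2 * (x₀ * x₆) + (- + 2 * (x₁ * x₅) + (+ 2 * (x₁ * x₆) + (- + 2 * (x₅ * x₆) + + 0)))))))))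
  expand = solve-∀
  collect : ∀ w₀ w₁ w₄ w₅ w₆ →
    + 1 * w₀ + (+ 1 * w₀ + (+ 1 * w₀ + (+ 1 * w₀ + (- + 2 * w₁ + (+ 2 * w₅
      + (- + 2 * w₆ + (- + 2 * w₄ + (+ 2 * w₅ + (- + 2 * w₁ + + 0)))))))))
    ≡ + 4 * w₀ - + 4 * w₁ + + 4 * w₅ - + 2 * w₄ - + 2 * w₆
  collect = solve-∀
  expansion : ∀ L → 7 ℕ.+ m ≤ L → ∑< L (twoRowChar² m)
    ≡ + 4 * offCentre m 0 - + 4 * offCentre m 1 + + 4 * offCentre m 5 - + 2 * offCentre m 4 - + 2 * offCentre m 6
  expansion L 7+m≤L =
    trans (∑<-cong L (λ j _ → trans (cong (λ t → t * t) (in-shifts j)) (expand (x 0 j) (x 1 j) (x 5 j) (x 6 j))))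
    (trans (term 0 0 (+ 1) (term 1 0 (+ 1) (term 5 0 (+ 1) (term 6 0 (+ 1) (term 0 1 (- + 2) (term 0 5 (+ 2)
             (term 0 6 (- + 2) (term 1 4 (- + 2) (term 1 5 (+ 2) (term 5 1 (- + 2) (∑<-0 L)))))))))))
           (collect (offCentre m 0) (offCentre m 1) (offCentre m 4) (offCentre m 5) (offCentre m 6)))
    where
    term : ∀ a d c {g : ℕ → ℤ} {r} {a≤6 : True (a ℕ.≤? 6)} → ∑< L g ≡ r →
           ∑< L (λ j → c * (x a j * x (a ℕ.+ d) j) + g j) ≡ c * offCentre m d + r
    term a d c {g} {a≤6 = a≤6} ∑g≡r = ∑<-linear L c (λ j → x a j * x (a ℕ.+ d) j) g
      (choose-correlation m a d L (ℕ.<-≤-trans (s≤s (ℕ.+-monoˡ-≤ m (toWitness a≤6))) 7+m≤L)) ∑g≡r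

lhsSum≡∑twoRowChar² : ∀ m → lhsSum (5 ℕ.+ m) ≡ ∑< (suc ((5 ℕ.+ m) / 2)) (twoRowChar² m)
lhsSum≡∑twoRowChar² m = trans (sumℤ-map-applyUpTo (suc k) χ² id) (∑<-cong (suc k) {χ²} (λ j j≤k → cong₂ _*_ (χ≡ j j≤k) (χ≡ j j≤k)))
  where
  k = (5 ℕ.+ m) / 2
  χ² : ℕ → ℤ
  χ² j = χ (twoRow (5 ℕ.+ m) j) (fiveOnes (5 ℕ.+ m)) * χ (twoRow (5 ℕ.+ m) j) (fiveOnes (5 ℕ.+ m))
  χ≡ : ∀ j → j < suc k → χ (twoRow (5 ℕ.+ m) j) (fiveOnes (5 ℕ.+ m)) ≡ twoRowChar m (+ j)
  χ≡ j (s≤s j≤k) = χ-twoRow-fiveOnes m j (ℕ.≤-trans (ℕ.+-mono-≤ j≤k j≤k) ([n/2]+[n/2]≤n (5 ℕ.+ m)))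

-- Clearing denominators

denominator : ℤ → ℤ
denominator n = + 16 * (+ 2 * n - + 1) * (+ 2 * n - + 3) * (+ 2 * n - + 5) * (+ 2 * n - + 7) * (n + + 1)

numerator : ℤ → ℤ
numerator n = n * n * n * n - + 38 * n * n * n + + 659 * n * n - + 4342 * n + + 10080

-- closedForm multiplied by (m+1)⋯(m+6), after telescoping every W_d and Z₅ down to W₀ = Z₀;
-- the products are written exactly as ∏< unfolds them.
closedForm-identity : ∀ (m : ℤ) →
  let n = + 5 + m in
  + 16 * (+ 2 * n - + 1) * (+ 2 * n - + 3) * (+ 2 * n - + 5) * (+ 2 * n - + 7) * (n + + 1)
    * (+ 4 * (+ 1 * (m + + 1) * (m + + 2) * (m + + 3) * (m + + 4) * (m + + 5) * (m + + 6))
     - + 4 * ((+ 1 * (m + + 2) * (m + + 3) * (m + + 4) * (m + + 5) * (m + + 6)) * (+ 1 * (m - + 0)))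
     + + 4 * ((+ 1 * (m + + 6)) * (+ 1 * (m - + 0) * (m - + 1) * (m - + 2) * (m - + 3) * (m - + 4)))
     - + 2 * ((+ 1 * (m + + 5) * (m + + 6)) * (+ 1 * (m - + 0) * (m - + 1) * (m - + 2) * (m - + 3)))
     - + 2 * (+ 1 * (+ 1 * (m - + 0) * (m - + 1) * (m - + 2) * (m - + 3) * (m - + 4) * (m - + 5))))
  ≡ + 2 * (n * n * n * n - + 38 * n * n * n + + 659 * n * n - + 4342 * n + + 10080)
    * ((+ 1 * (m + + 6))
       * (+ 1 * (+ 4 * (m + + 0) + + 2) * (+ 4 * (m + + 1) + + 2) * (+ 4 * (m + + 2) + + 2) * (+ 4 * (m + + 3) + + 2) * (+ 4 * (m + + 4) + + 2)))
closedForm-identity = solve-∀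

rising-*-cancelˡ : ∀ m k {x y} → ∏< k (λ i → + m + + suc i) * x ≡ ∏< k (λ i → + m + + suc i) * y → x ≡ y
rising-*-cancelˡ m zero    {x} {y} eq = trans (sym (ℤ.*-identityˡ x)) (trans eq (ℤ.*-identityˡ y))
rising-*-cancelˡ m (suc k) {x} {y} eq =
  ℤ.*-cancelˡ-≡ (+ suc (m ℕ.+ k)) x y
    (subst (λ c → c * x ≡ c * y) (cong +_ (ℕ.+-suc m k))
      (rising-*-cancelˡ m k (trans (sym (ℤ.*-assoc p a x)) (trans eq (ℤ.*-assoc p a y)))))
  where
  p = ∏< k (λ i → + m + + suc i)
  a = + m + + suc k

closedForm : ∀ m (S : ℤ) (W Z : ℕ → ℤ) →
  (∀ d → (+ m + + suc d) * W (suc d) ≡ (+ m - + d) * W d) →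
  (∀ d → (+ m + + suc d) * Z (suc d) ≡ (+ 4 * (+ m + + d) + + 2) * Z d) →
  Z 0 ≡ W 0 →
  + 2 * S ≡ + 4 * W 0 - + 4 * W 1 + + 4 * W 5 - + 2 * W 4 - + 2 * W 6 →
  S * denominator (+ 5 + + m) ≡ numerator (+ 5 + + m) * Z 5
closedForm m S W Z W-step Z-step Z₀≡W₀ 2S≡ = ℤ.*-cancelˡ-≡ (+ 2) (S * K) (P * Z 5) (rising-*-cancelˡ m 6 (begin
  R * (+ 2 * (S * K))
    ≡⟨ regroup R S K ⟩
  K * (R * (+ 2 * S))
    ≡⟨ cong (λ t → K * (R * t)) 2S≡ ⟩
  K * (R * (+ 4 * X - + 4 * W 1 + + 4 * W 5 - + 2 * W 4 - + 2 * W 6))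
    ≡⟨ cong (K *_) (distribute R X (W 1) (W 4) (W 5) (W 6)) ⟩
  K * (+ 4 * (R * X) - + 4 * (R * W 1) + + 4 * (R * W 5) - + 2 * (R * W 4) - + 2 * (R * W 6))
    ≡⟨ cong (K *_) (cong₂ _-_ (cong₂ _-_ (cong₂ _+_ (cong (_-_ (+ 4 * (R * X))) (cong (+ 4 *_) (W-scaled 1 5)))
                                                    (cong (+ 4 *_) (W-scaled 5 1)))
                                         (cong (+ 2 *_) (W-scaled 4 2)))
                              (cong (+ 2 *_) (W-scaled 6 0))) ⟩
  K * (+ 4 * (R * X) - + 4 * (c₁ * X) + + 4 * (c₅ * X) - + 2 * (c₄ * X) - + 2 * (c₆ * X))
    ≡⟨ factor K R c₁ c₄ c₅ c₆ X ⟩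
  (K * (+ 4 * R - + 4 * c₁ + + 4 * c₅ - + 2 * c₄ - + 2 * c₆)) * X
    ≡⟨ cong (_* X) (closedForm-identity (+ m)) ⟩
  (+ 2 * P * (t₅ * G)) * X
    ≡⟨ ℤ.*-assoc (+ 2 * P) (t₅ * G) X ⟩
  + 2 * P * ((t₅ * G) * X)
    ≡⟨ cong (λ z → + 2 * P * ((t₅ * G) * z)) Z₀≡W₀ ⟨
  + 2 * P * ((t₅ * G) * Z 0)
    ≡⟨ cong (+ 2 * P *_) (∏<-telescope-+ a g Z Z-step 5 1) ⟨
  + 2 * P * (R * Z 5)
    ≡⟨ regroup′ R P (Z 5) ⟩
  R * (+ 2 * (P * Z 5)) ∎))
  where
  n = + 5 + + m
  K = denominator n
  P = numerator n
  X = W 0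
  a f g : ℕ → ℤ
  a i = + m + + suc i
  f i = + m - + i
  g i = + 4 * (+ m + + i) + + 2
  R = ∏< 6 a
  c : ℕ → ℕ → ℤ
  c d e = ∏< e (λ i → a (d ℕ.+ i)) * ∏< d f
  c₁ = c 1 5
  c₄ = c 4 2
  c₅ = c 5 1
  c₆ = c 6 0
  t₅ = ∏< 1 (λ i → a (5 ℕ.+ i))
  G = ∏< 5 g
  W-scaled : ∀ d e → ∏< (d ℕ.+ e) a * W d ≡ c d e * X
  W-scaled = ∏<-telescope-+ a f W W-step
  regroup : ∀ r s k → r * (+ 2 * (s * k)) ≡ k * (r * (+ 2 * s))
  regroup = solve-∀
  regroup′ : ∀ r p z → + 2 * p * (r * z) ≡ r * (+ 2 * (p * z))
  regroup′ = solve-∀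
  distribute : ∀ r x₀ x₁ x₄ x₅ x₆ → r * (+ 4 * x₀ - + 4 * x₁ + + 4 * x₅ - + 2 * x₄ - + 2 * x₆)
             ≡ + 4 * (r * x₀) - + 4 * (r * x₁) + + 4 * (r * x₅) - + 2 * (r * x₄) - + 2 * (r * x₆)
  distribute = solve-∀
  factor : ∀ k r c₁ c₄ c₅ c₆ x → k * (+ 4 * (r * x) - + 4 * (c₁ * x) + + 4 * (c₅ * x) - + 2 * (c₄ * x) - + 2 * (c₆ * x))
         ≡ (k * (+ 4 * r - + 4 * c₁ + + 4 * c₅ - + 2 * c₄ - + 2 * c₆)) * x
  factor = solve-∀

mainTheorem15 : (n : ℕ) → 5 ≤ n →
    lhsSum n * (+ 16 * (+ 2 * + n - + 1) * (+ 2 * + n - + 3) * (+ 2 * + n - + 5) * (+ 2 * + n - + 7) * (+ n + + 1))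
      ≡ (+ n * + n * + n * + n - + 38 * + n * + n * + n + + 659 * + n * + n - + 4342 * + n + + 10080) * + ((2 *ℕ n) C n)
mainTheorem15 n 5≤n with ℕ.m≤n⇒∃[o]m+o≡n 5≤n
... | m , refl = begin
  lhsSum n * denominator (+ n)                ≡⟨ cong (_* denominator (+ n)) (lhsSum≡∑twoRowChar² m) ⟩
  S * denominator (+ n)                       ≡⟨ closedForm m S (offCentre m) (λ d → centralBinomial (m ℕ.+ d))
                                                   (offCentre-step m) (centralBinomial-step m) Z₀≡W₀ 2S≡ ⟩
  numerator (+ n) * centralBinomial (m ℕ.+ 5) ≡⟨ cong (numerator (+ n) *_) Z₅≡ ⟩
  numerator (+ n) * + ((2 *ℕ n) C n)          ∎
  where
  S = ∑< (suc (n / 2)) (twoRowChar² m)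
  2S≡ : + 2 * S ≡ + 4 * offCentre m 0 - + 4 * offCentre m 1 + + 4 * offCentre m 5 - + 2 * offCentre m 4 - + 2 * offCentre m 6
  2S≡ = trans (sym (∑twoRowChar²-fold m)) (∑twoRowChar² m)
  Z₀≡W₀ : centralBinomial (m ℕ.+ 0) ≡ offCentre m 0
  Z₀≡W₀ = cong (λ k → + ((k ℕ.+ k) C (m ℕ.+ 0))) (ℕ.+-identityʳ m)
  Z₅≡ : centralBinomial (m ℕ.+ 5) ≡ + ((2 *ℕ n) C n)
  Z₅≡ = trans (cong centralBinomial (ℕ.+-comm m 5)) (cong (λ t → + ((n ℕ.+ t) C n)) (sym (ℕ.+-identityʳ n)))
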